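{- Let $M$ be a wide ACI-matrix over a field $\mathbb{F}$ (more columns than rows). Any two semifactor sets of $M$ have nonempty intersection.
   Context: Let $\mathbb{F}$ be a field. An ACI-matrix over $\mathbb{F}$ is a matrix with entries in $\mathbb{F}[x_1,\dots,x_k]$, each a polynomial of degree at most one, such that no indeterminate appears in two different columns; matrices/blocks with no rows and/or no columns are allowed (a $0\times q$ matrix, $q>0$, is wide degenerate; a $p\times 0$ matrix, $p>0$, is tall degenerate; $0\times 0$ is void). A completion is an assignment of values in $\mathbb{F}$ to all indeterminates; $\operatorname{maxRank}(N)$ is the maximum rank of a completion of $N$. $N$ is FRmR if $\operatorname{maxRank}(N)=\operatorname{rows}(N)$ and FCmR if $\operatorname{maxRank}(N)=\operatorname{cols}(N)$; by convention tall degenerate matrices are FRmR, wide degenerate matrices FCmR, and the void matrix both. Let $M$ be $m\times n$. For $F\subseteq\{1,\dots,n\}$, $\#F=s$, $Q_F$ is the $n\times n$ permutation matrix such that $MQ_F$ places the columns indexed by $F$ in positions $1,\dots,s$ and the remaining columns in positions $s+1,\dots,n$ (each group in increasing order). $F$ is a semifactor set of $M$ if there is a nonsingular constant matrix $R$ of order $m$ with $RMQ_F=\begin{bmatrix} A & B\\ 0 & C\end{bmatrix}$, where $A$ consists of the first $s$ columns, the lower-left block is an $r\times s$ block of zeros with $r+s=\max\{m,n\}$ (a Medium zero block), $A$ is FRmR and $C$ is FCmR. -}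

module Defs where

open import Level using (Level)
open import Algebra.Bundles using (CommutativeRing)
import Data.Nat as ℕ
open ℕ using (ℕ; zero; suc)
open import Data.Fin as Fin using (Fin; toℕ; _↑ˡ_; _↑ʳ_; cast)
open import Data.Fin.Subset using (Subset; _∈_; ∣_∣)
open import Data.Product using (Σ; ∃; ∃-syntax; _×_; _,_)
open import Data.Sum using (_⊎_)
open import Relation.Nullary using (¬_)
open import Relation.Binary.PropositionalEquality using (_≡_)
open import Function.Definitions using (Injective; Surjective)

record Field (c ℓ : Level) : Set (Level.suc (c Level.⊔ ℓ)) where
  field
    commutativeRing : CommutativeRing c ℓ
  open CommutativeRing commutativeRing public
  field
    0≉1     : ¬ (0# ≈ 1#)
    inverse : ∀ x → ¬ (x ≈ 0#) → ∃[ y ] (x * y ≈ 1#)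

module _ {c ℓ : Level} (𝔽 : Field c ℓ) where
  open Field 𝔽

  ∑ : ∀ {n} → (Fin n → Carrier) → Carrier
  ∑ {zero}  f = 0#
  ∑ {suc n} f = f Fin.zero + ∑ (λ i → f (Fin.suc i))

  CMat : ℕ → ℕ → Set c
  CMat m n = Fin m → Fin n → Carrier

  _⊗_ : ∀ {m l n} → CMat m l → CMat l n → CMat m n
  (A ⊗ B) i j = ∑ (λ t → A i t * B t j)

  identity : ∀ {m} → CMat m m
  identity i j with i Fin.≟ j
  ... | Relation.Nullary.yes _ = 1#
  ... | Relation.Nullary.no  _ = 0#

  _≈ₘ_ : ∀ {m n} → CMat m n → CMat m n → Set ℓ
  A ≈ₘ B = ∀ i j → A i j ≈ B i j

  Nonsingular : ∀ {m} → CMat m m → Set (c Level.⊔ ℓ)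
  Nonsingular {m} R = ∃[ R' ] ((R' ⊗ R) ≈ₘ identity × (R ⊗ R') ≈ₘ identity)

  RowsIndependent : ∀ {m n} → CMat m n → Set (c Level.⊔ ℓ)
  RowsIndependent {m} {n} A =
    ∀ (a : Fin m → Carrier) → (∀ j → ∑ (λ i → a i * A i j) ≈ 0#) → ∀ i → a i ≈ 0#

  ColsIndependent : ∀ {m n} → CMat m n → Set (c Level.⊔ ℓ)
  ColsIndependent {m} {n} A =
    ∀ (a : Fin n → Carrier) → (∀ i → ∑ (λ j → A i j * a j) ≈ 0#) → ∀ j → a j ≈ 0#

  -- Polynomials of degree at most one in the indeterminates x_0..x_{k-1}:
  -- const + Σ_v coef v * x_v

  record Aff (k : ℕ) : Set c where
    constructor aff
    field
      const : Carrier
      coef  : Fin k → Carrier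
  open Aff public

  IsZeroPoly : ∀ {k} → Aff k → Set ℓ
  IsZeroPoly p = const p ≈ 0# × (∀ v → coef p v ≈ 0#)

  PMat : ℕ → ℕ → ℕ → Set c
  PMat k m n = Fin m → Fin n → Aff k

  IsACI : ∀ {k m n} → PMat k m n → Set ℓ
  IsACI M = ∀ v i j i' j' → ¬ (coef (M i j) v ≈ 0#) → ¬ (coef (M i' j') v ≈ 0#) → j ≡ j'

  evalAff : ∀ {k} → (Fin k → Carrier) → Aff k → Carrier
  evalAff x p = const p + ∑ (λ v → coef p v * x v)

  complete : ∀ {k m n} → (Fin k → Carrier) → PMat k m n → CMat m n
  complete x M i j = evalAff x (M i j)

  -- maxRank N = rows N  (with the convention: tall degenerate ⇒ FRmR)
  FRmR : ∀ {k m n} → PMat k m n → Set (c Level.⊔ ℓ)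
  FRmR {k} {m} {n} N = n ≡ 0 ⊎ ∃[ x ] RowsIndependent (complete x N)

  -- maxRank N = cols N  (with the convention: wide degenerate ⇒ FCmR)
  FCmR : ∀ {k m n} → PMat k m n → Set (c Level.⊔ ℓ)
  FCmR {k} {m} {n} N = m ≡ 0 ⊎ ∃[ x ] ColsIndependent (complete x N)

  _⊙_ : ∀ {k m l n} → CMat m l → PMat k l n → PMat k m n
  (R ⊙ M) i j = aff (∑ (λ t → R i t * const (M t j)))
                    (λ v → ∑ (λ t → R i t * coef (M t j) v))

  permCols : ∀ {k m n} → PMat k m n → (Fin n → Fin n) → PMat k m n
  permCols M σ i q = M i (σ q)

  -- σ describes Q_F: positions 0..s-1 carry the columns of F in increasing
  -- order, positions s..n-1 the remaining columns in increasing order.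
  IsQ : ∀ {n} → Subset n → (Fin n → Fin n) → Set
  IsQ F σ =
    Injective _≡_ _≡_ σ × Surjective _≡_ _≡_ σ ×
    (∀ q → (toℕ q ℕ.< ∣ F ∣ → σ q ∈ F) × (σ q ∈ F → toℕ q ℕ.< ∣ F ∣)) ×
    (∀ q q' → toℕ q ℕ.< toℕ q' → toℕ q' ℕ.< ∣ F ∣ → toℕ (σ q) ℕ.< toℕ (σ q')) ×
    (∀ q q' → toℕ q ℕ.< toℕ q' → ∣ F ∣ ℕ.≤ toℕ q → toℕ (σ q) ℕ.< toℕ (σ q'))

  SemifactorSet : ∀ {k m n} → PMat k m n → Subset n → Set (c Level.⊔ ℓ)
  SemifactorSet {k} {m} {n} M F =
    ∃[ σ ] IsQ F σ ×
    ∃[ R ] Nonsingular R ×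
    ∃[ p ] ∃[ r ] ∃[ t ] Σ (p ℕ.+ r ≡ m) λ eqm → Σ (∣ F ∣ ℕ.+ t ≡ n) λ eqn →
      r ℕ.+ ∣ F ∣ ≡ m ℕ.⊔ n ×
      (let N = permCols (R ⊙ M) σ
           top : Fin p → Fin m
           top i = cast eqm (i ↑ˡ r)
           bot : Fin r → Fin m
           bot i = cast eqm (p ↑ʳ i)
           lft : Fin ∣ F ∣ → Fin n
           lft j = cast eqn (j ↑ˡ t)
           rgt : Fin t → Fin n
           rgt j = cast eqn (∣ F ∣ ↑ʳ j)
           A : PMat k p ∣ F ∣
           A i j = N (top i) (lft j)
           C : PMat k r t
           C i j = N (bot i) (rgt j)
       in (∀ i j → IsZeroPoly (N (bot i) (lft j))) × FRmR A × FCmR C)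

module Submission where

-- Idea.  Write X for a completion of M.  Two complementary facts hold:
--
--   * (kernel)  If F is a semifactor set and m < n, then for EVERY
--     completion X there is a nonzero u with X u = 0 whose support lies
--     in F.  Indeed, the upper-left block A of R M Q_F is p × #F with
--     p < #F, so A has a nonzero kernel vector b; placing b on the
--     columns of F (and 0 elsewhere) gives u with (R X) u = 0, because
--     the lower-left block vanishes, and hence X u = 0 as R is nonsingular.
--   * (rigidity)  If G is a semifactor set, then for SOME completion X
--     every u with X u = 0 vanishing on G is zero: restricted to the
--     lower rows of R X, such a u is a kernel vector of the FCmR block C.
--
-- If F ∩ G were empty, the vector of the first fact (for the completion
-- given by the second) would vanish on G, hence be zero: contradiction.
-- Since fields need not have decidable equality, the existence of kernel
-- vectors of underdetermined systems is proved under double negation,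
-- which suffices because F ∩ G = ∅ is decidable.

open import Defs
open import Level using (Level; _⊔_)
import Data.Nat as ℕ
open ℕ using (ℕ; zero; suc; _<_; _≤_; s≤s)
import Data.Nat.Properties as ℕP
open import Data.Fin as Fin using (Fin; toℕ; _↑ˡ_; _↑ʳ_; cast; splitAt; punchIn)
import Data.Fin.Properties as FinP
open import Data.Fin.Subset using (Subset; _∈_; _∉_; ∣_∣)
open import Data.Fin.Subset.Properties using (_∈?_)
open import Data.Fin.Permutation using (permutation)
open import Data.Vec.Functional using (_++_; insertAt)
open import Data.Vec.Functional.Properties
  using (lookup-++ˡ; lookup-++ʳ; insertAt-lookup; insertAt-punchIn)
open import Data.Product using (∃; ∃-syntax; _×_; _,_; proj₁; proj₂)
open import Data.Sum using (_⊎_; inj₁; inj₂)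
open import Data.Empty using (⊥; ⊥-elim)
open import Function using (_∘_)
open import Relation.Nullary using (¬_; yes; no)
open import Relation.Nullary.Negation using (¬¬-map; negated-stable)
open import Relation.Nullary.Decidable using (decidable-stable; ¬¬-excluded-middle; _×-dec_)
open import Relation.Unary using (Decidable)
import Relation.Binary.PropositionalEquality as ≡
open ≡ using (_≡_)

¬¬-bind : ∀ {a b} {A : Set a} {B : Set b} → ¬ ¬ A → (A → ¬ ¬ B) → ¬ ¬ B
¬¬-bind ¬¬a f = negated-stable (¬¬-map f ¬¬a)

¬¬-decidable : ∀ {p} n (P : Fin n → Set p) → ¬ ¬ Decidable P
¬¬-decidable zero    P k = k (λ ())
¬¬-decidable (suc n) P =
  ¬¬-bind ¬¬-excluded-middle λ P₀? →
  ¬¬-bind (¬¬-decidable n (P ∘ Fin.suc)) λ P₊? k →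
  k (λ { Fin.zero → P₀? ; (Fin.suc j) → P₊? j })

¬¬-all-or-counterexample : ∀ {p} n (P : Fin n → Set p) →
  ¬ ¬ ((∀ j → P j) ⊎ ∃ λ j → ¬ P j)
¬¬-all-or-counterexample n P = ¬¬-map decide (¬¬-decidable n P)
  where
  decide : Decidable P → (∀ j → P j) ⊎ ∃ λ j → ¬ P j
  decide P? with FinP.all? P?
  ... | yes all = inj₁ all
  ... | no ¬all = inj₂ (FinP.¬∀⟶∃¬ n P P? ¬all)

module Blocks {s t n : ℕ} (eq : s ℕ.+ t ≡ n) where

  lft : Fin s → Fin n
  lft j = cast eq (j ↑ˡ t)

  rgt : Fin t → Fin n
  rgt j = cast eq (s ↑ʳ j)

  cover : ∀ q → (∃ λ j → lft j ≡ q) ⊎ (∃ λ j → rgt j ≡ q)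
  cover q with splitAt s (cast (≡.sym eq) q) in e
  ... | inj₁ j = inj₁ (j , ≡.trans (≡.cong (cast eq) (FinP.splitAt⁻¹-↑ˡ e))
                                  (FinP.cast-involutive eq (≡.sym eq) q))
  ... | inj₂ j = inj₂ (j , ≡.trans (≡.cong (cast eq) (FinP.splitAt⁻¹-↑ʳ e))
                                  (FinP.cast-involutive eq (≡.sym eq) q))

  toℕ-lft : ∀ j → toℕ (lft j) < s
  toℕ-lft j rewrite FinP.toℕ-cast eq (j ↑ˡ t) | FinP.toℕ-↑ˡ j t = FinP.toℕ<n j

  toℕ-rgt : ∀ j → s ≤ toℕ (rgt j)
  toℕ-rgt j rewrite FinP.toℕ-cast eq (s ↑ʳ j) | FinP.toℕ-↑ʳ s j = ℕP.m≤m+n s (toℕ j)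

  join : ∀ {a} {A : Set a} → (Fin s → A) → (Fin t → A) → Fin n → A
  join b d q = (b ++ d) (cast (≡.sym eq) q)

  join-lft : ∀ {a} {A : Set a} (b : Fin s → A) (d : Fin t → A) j → join b d (lft j) ≡ b j
  join-lft b d j = ≡.trans (≡.cong (b ++ d) (FinP.cast-involutive (≡.sym eq) eq (j ↑ˡ t)))
                           (lookup-++ˡ b d j)

  join-rgt : ∀ {a} {A : Set a} (b : Fin s → A) (d : Fin t → A) j → join b d (rgt j) ≡ d j
  join-rgt b d j = ≡.trans (≡.cong (b ++ d) (FinP.cast-involutive (≡.sym eq) eq (s ↑ʳ j)))
                           (lookup-++ʳ b d j)

wide-upper-block : ∀ {m n p r s t} → p ℕ.+ r ≡ m → s ℕ.+ t ≡ n → r ℕ.+ s ≡ m ℕ.⊔ n →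
  m < n → p < s
wide-upper-block {m} {n} {p} {r} {s} eqm eqn eqmax m<n =
  ℕP.+-cancelʳ-< r p s (≡.subst₂ _<_ (≡.sym eqm) n≡s+r m<n)
  where
  n≡s+r : n ≡ s ℕ.+ r
  n≡s+r = ≡.trans (≡.sym (ℕP.m≤n⇒m⊔n≡n (ℕP.<⇒≤ m<n)))
                      (≡.trans (≡.sym eqmax) (ℕP.+-comm r s))

lower-right-block : ∀ {m n r s t} → s ℕ.+ t ≡ n → r ℕ.+ s ≡ m ℕ.⊔ n → t ≤ r
lower-right-block {m} {n} {r} {s} {t} eqn eqmax = ℕP.+-cancelʳ-≤ s t r (begin
  t ℕ.+ s     ≡⟨ ℕP.+-comm t s ⟩
  s ℕ.+ t     ≡⟨ eqn ⟩
  n         ≤⟨ ℕP.m≤n⊔m m n ⟩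
  m ℕ.⊔ n   ≡⟨ ≡.sym eqmax ⟩
  r ℕ.+ s     ∎)
  where open ℕP.≤-Reasoning

module _ {c ℓ : Level} (𝔽 : Field c ℓ) where
  open Field 𝔽
  open import Algebra.Properties.Ring ring using (-‿distribˡ-*; -‿distribʳ-*)
  open import Algebra.Properties.CommutativeSemigroup *-commutativeSemigroup
    using (x∙yz≈y∙xz)
  import Algebra.Properties.Semiring.Sum semiring as Sum
  open import Relation.Binary.Reasoning.Setoid setoid

  Vec𝔽 : ℕ → Set c
  Vec𝔽 n = Fin n → Carrier

  ∑𝔽 : ∀ {n} → Vec𝔽 n → Carrier
  ∑𝔽 = ∑ 𝔽

  ∑≡sum : ∀ {n} (f : Vec𝔽 n) → ∑𝔽 f ≡ Sum.sum f
  ∑≡sum {zero}  f = ≡.refl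
  ∑≡sum {suc n} f = ≡.cong (f Fin.zero +_) (∑≡sum (f ∘ Fin.suc))

  ∑-cong : ∀ {n} {f g : Vec𝔽 n} → (∀ i → f i ≈ g i) → ∑𝔽 f ≈ ∑𝔽 g
  ∑-cong {f = f} {g} f≈g rewrite ∑≡sum f | ∑≡sum g = Sum.sum-cong-≋ f≈g

  ∑-zero : ∀ {n} {f : Vec𝔽 n} → (∀ i → f i ≈ 0#) → ∑𝔽 f ≈ 0#
  ∑-zero {n} {f} f≈0 rewrite ∑≡sum f =
    trans (Sum.sum-cong-≋ f≈0) (Sum.sum-replicate-zero n)

  ∑-+ : ∀ {n} (f g : Vec𝔽 n) → ∑𝔽 (λ i → f i + g i) ≈ ∑𝔽 f + ∑𝔽 g
  ∑-+ f g rewrite ∑≡sum (λ i → f i + g i) | ∑≡sum f | ∑≡sum g = Sum.∑-distrib-+ f g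

  ∑-*ˡ : ∀ {n} d (f : Vec𝔽 n) → ∑𝔽 (λ i → d * f i) ≈ d * ∑𝔽 f
  ∑-*ˡ d f rewrite ∑≡sum (λ i → d * f i) | ∑≡sum f = sym (Sum.*-distribˡ-sum d f)

  ∑-*ʳ : ∀ {n} d (f : Vec𝔽 n) → ∑𝔽 (λ i → f i * d) ≈ ∑𝔽 f * d
  ∑-*ʳ d f rewrite ∑≡sum (λ i → f i * d) | ∑≡sum f = sym (Sum.*-distribʳ-sum d f)

  ∑-comm : ∀ {m n} (f : Fin m → Fin n → Carrier) →
    ∑𝔽 (λ i → ∑𝔽 (f i)) ≈ ∑𝔽 (λ j → ∑𝔽 (λ i → f i j))
  ∑-comm f
    rewrite ∑≡sum (λ i → ∑𝔽 (f i)) | ∑≡sum (λ j → ∑𝔽 (λ i → f i j))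
          | Sum.sum-cong-≗ (λ i → ∑≡sum (f i))
          | Sum.sum-cong-≗ (λ j → ∑≡sum (λ i → f i j)) = Sum.∑-comm f

  ∑-remove : ∀ {n} (f : Vec𝔽 (suc n)) i → ∑𝔽 f ≈ f i + ∑𝔽 (f ∘ punchIn i)
  ∑-remove f i rewrite ∑≡sum f | ∑≡sum (f ∘ punchIn i) = Sum.sum-remove f

  ∑-permute : ∀ {m n} (σ : Fin m → Fin n) (τ : Fin n → Fin m) →
    (∀ c → σ (τ c) ≡ c) → (∀ q → τ (σ q) ≡ q) →
    ∀ h → ∑𝔽 h ≈ ∑𝔽 (h ∘ σ)
  ∑-permute σ τ στ τσ h rewrite ∑≡sum h | ∑≡sum (h ∘ σ) =
    Sum.∑-permute h (permutation σ τ στ τσ)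

  ∑-↑ : ∀ {s t} (h : Vec𝔽 (s ℕ.+ t)) →
    ∑𝔽 h ≈ ∑𝔽 (λ j → h (j ↑ˡ t)) + ∑𝔽 (λ j → h (s ↑ʳ j))
  ∑-↑ {zero}  h = sym (+-identityˡ _)
  ∑-↑ {suc s} {t} h = trans (+-congˡ (∑-↑ {s} {t} (h ∘ Fin.suc))) (sym (+-assoc _ _ _))

  ∑-blocks : ∀ {s t n} (eq : s ℕ.+ t ≡ n) (h : Vec𝔽 n) →
    ∑𝔽 h ≈ ∑𝔽 (h ∘ Blocks.lft {s} {t} eq) + ∑𝔽 (h ∘ Blocks.rgt {s} {t} eq)
  ∑-blocks {s} {t} eq h =
    trans (∑-permute (cast eq) (cast (≡.sym eq))
                     (FinP.cast-involutive eq (≡.sym eq))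
                     (FinP.cast-involutive (≡.sym eq) eq) h)
          (∑-↑ {s} {t} (h ∘ cast eq))

  ∑-lincomb : ∀ {n} x y (f g b : Vec𝔽 n) →
    ∑𝔽 (λ k → (x * f k + y * g k) * b k) ≈
      x * ∑𝔽 (λ k → f k * b k) + y * ∑𝔽 (λ k → g k * b k)
  ∑-lincomb x y f g b = begin
    ∑𝔽 (λ k → (x * f k + y * g k) * b k)
      ≈⟨ ∑-cong (λ k → trans (distribʳ (b k) _ _)
                             (+-cong (*-assoc x (f k) (b k)) (*-assoc y (g k) (b k)))) ⟩
    ∑𝔽 (λ k → x * (f k * b k) + y * (g k * b k))
      ≈⟨ ∑-+ (λ k → x * (f k * b k)) (λ k → y * (g k * b k)) ⟩
    ∑𝔽 (λ k → x * (f k * b k)) + ∑𝔽 (λ k → y * (g k * b k))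
      ≈⟨ +-cong (∑-*ˡ x (λ k → f k * b k)) (∑-*ˡ y (λ k → g k * b k)) ⟩
    x * ∑𝔽 (λ k → f k * b k) + y * ∑𝔽 (λ k → g k * b k) ∎

  *-nonzero : ∀ {x y} → ¬ x ≈ 0# → ¬ y ≈ 0# → ¬ x * y ≈ 0#
  *-nonzero {x} {y} x≉0 y≉0 xy≈0 with inverse x x≉0
  ... | x⁻¹ , xx⁻¹≈1 = y≉0 (begin
    y               ≈⟨ sym (*-identityˡ y) ⟩
    1# * y          ≈⟨ *-congʳ (sym xx⁻¹≈1) ⟩
    (x * x⁻¹) * y   ≈⟨ *-congʳ (*-comm x x⁻¹) ⟩
    (x⁻¹ * x) * y   ≈⟨ *-assoc x⁻¹ x y ⟩
    x⁻¹ * (x * y)   ≈⟨ *-congˡ xy≈0 ⟩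
    x⁻¹ * 0#        ≈⟨ zeroʳ x⁻¹ ⟩
    0#              ∎)

  infixr 7 _▸_
  _▸_ : ∀ {m n} → CMat 𝔽 m n → Vec𝔽 n → Vec𝔽 m
  (A ▸ u) i = ∑𝔽 (λ j → A i j * u j)

  IsZeroVec : ∀ {n} → Vec𝔽 n → Set ℓ
  IsZeroVec v = ∀ i → v i ≈ 0#

  ▸-zero : ∀ {m n} (A : CMat 𝔽 m n) {v} → IsZeroVec v → IsZeroVec (A ▸ v)
  ▸-zero A v≈0 i = ∑-zero (λ j → trans (*-congˡ (v≈0 j)) (zeroʳ _))

  ▸-congˡ : ∀ {m n} {A B : CMat 𝔽 m n} → _≈ₘ_ 𝔽 A B → ∀ u i → (A ▸ u) i ≈ (B ▸ u) i
  ▸-congˡ A≈B u i = ∑-cong (λ j → *-congʳ (A≈B i j))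

  ▸-assoc : ∀ {m l n} (A : CMat 𝔽 m l) (B : CMat 𝔽 l n) u i →
    (_⊗_ 𝔽 A B ▸ u) i ≈ (A ▸ B ▸ u) i
  ▸-assoc A B u i = begin
    ∑𝔽 (λ j → ∑𝔽 (λ t → A i t * B t j) * u j)
      ≈⟨ ∑-cong (λ j → sym (∑-*ʳ (u j) (λ t → A i t * B t j))) ⟩
    ∑𝔽 (λ j → ∑𝔽 (λ t → A i t * B t j * u j))
      ≈⟨ ∑-comm (λ j t → A i t * B t j * u j) ⟩
    ∑𝔽 (λ t → ∑𝔽 (λ j → A i t * B t j * u j))
      ≈⟨ ∑-cong (λ t → trans (∑-cong (λ j → *-assoc (A i t) (B t j) (u j)))
                             (∑-*ˡ (A i t) (λ j → B t j * u j))) ⟩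
    ∑𝔽 (λ t → A i t * ∑𝔽 (λ j → B t j * u j)) ∎

  ▸-identity : ∀ {n} (u : Vec𝔽 n) i → (identity 𝔽 ▸ u) i ≈ u i
  ▸-identity {suc n} u i = begin
    (identity 𝔽 ▸ u) i
      ≈⟨ ∑-remove (λ j → identity 𝔽 i j * u j) i ⟩
    identity 𝔽 i i * u i + ∑𝔽 (λ j → identity 𝔽 i (punchIn i j) * u (punchIn i j))
      ≈⟨ +-cong (trans (*-congʳ diagonal) (*-identityˡ (u i)))
                (∑-zero (λ j → trans (*-congʳ (off-diagonal j)) (zeroˡ _))) ⟩
    u i + 0#
      ≈⟨ +-identityʳ (u i) ⟩
    u i ∎
    where
    diagonal : identity 𝔽 i i ≈ 1#
    diagonal with i Fin.≟ i
    ... | yes _  = refl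
    ... | no i≢i = ⊥-elim (i≢i ≡.refl)
    off-diagonal : ∀ j → identity 𝔽 i (punchIn i j) ≈ 0#
    off-diagonal j with i Fin.≟ punchIn i j
    ... | yes i≡ = ⊥-elim (FinP.punchInᵢ≢i i j (≡.sym i≡))
    ... | no _   = refl

  nonsingular-injective : ∀ {m} {R : CMat 𝔽 m m} → Nonsingular 𝔽 R →
    ∀ {v} → IsZeroVec (R ▸ v) → IsZeroVec v
  nonsingular-injective {R = R} (R′ , R′R≈1 , _) {v} Rv≈0 i = begin
    v i                      ≈⟨ sym (▸-identity v i) ⟩
    (identity 𝔽 ▸ v) i       ≈⟨ ▸-congˡ (λ i j → sym (R′R≈1 i j)) v i ⟩
    (_⊗_ 𝔽 R′ R ▸ v) i       ≈⟨ ▸-assoc R′ R v i ⟩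
    (R′ ▸ R ▸ v) i           ≈⟨ ▸-zero R′ Rv≈0 i ⟩
    0#                       ∎

  complete-⊙ : ∀ {k m l n} (x : Vec𝔽 k) (R : CMat 𝔽 m l) (M : PMat 𝔽 k l n) →
    _≈ₘ_ 𝔽 (complete 𝔽 x (_⊙_ 𝔽 R M)) (_⊗_ 𝔽 R (complete 𝔽 x M))
  complete-⊙ x R M i j = begin
    ∑𝔽 (λ t → R i t * const (M t j)) + ∑𝔽 (λ v → ∑𝔽 (λ t → R i t * coef (M t j) v) * x v)
      ≈⟨ +-congˡ (∑-cong (λ v → sym (∑-*ʳ (x v) (λ t → R i t * coef (M t j) v)))) ⟩
    ∑𝔽 (λ t → R i t * const (M t j)) + ∑𝔽 (λ v → ∑𝔽 (λ t → R i t * coef (M t j) v * x v))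
      ≈⟨ +-congˡ (∑-comm (λ v t → R i t * coef (M t j) v * x v)) ⟩
    ∑𝔽 (λ t → R i t * const (M t j)) + ∑𝔽 (λ t → ∑𝔽 (λ v → R i t * coef (M t j) v * x v))
      ≈⟨ +-congˡ (∑-cong (λ t → trans (∑-cong (λ v → *-assoc (R i t) (coef (M t j) v) (x v)))
                                       (∑-*ˡ (R i t) (λ v → coef (M t j) v * x v)))) ⟩
    ∑𝔽 (λ t → R i t * const (M t j)) + ∑𝔽 (λ t → R i t * ∑𝔽 (λ v → coef (M t j) v * x v))
      ≈⟨ sym (∑-+ (λ t → R i t * const (M t j))
                  (λ t → R i t * ∑𝔽 (λ v → coef (M t j) v * x v))) ⟩
    ∑𝔽 (λ t → R i t * const (M t j) + R i t * ∑𝔽 (λ v → coef (M t j) v * x v))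
      ≈⟨ ∑-cong (λ t → sym (distribˡ (R i t) _ _)) ⟩
    ∑𝔽 (λ t → R i t * complete 𝔽 x M t j) ∎

  complete-⊙-▸ : ∀ {k m l n} (x : Vec𝔽 k) (R : CMat 𝔽 m l) (M : PMat 𝔽 k l n) u i →
    (complete 𝔽 x (_⊙_ 𝔽 R M) ▸ u) i ≈ (R ▸ complete 𝔽 x M ▸ u) i
  complete-⊙-▸ x R M u i =
    trans (▸-congˡ (complete-⊙ x R M) u i) (▸-assoc R (complete 𝔽 x M) u i)

  evalAff-zero : ∀ {k} (x : Vec𝔽 k) {q : Aff 𝔽 k} → IsZeroPoly 𝔽 q → evalAff 𝔽 x q ≈ 0#
  evalAff-zero x (const≈0 , coef≈0) =
    trans (+-cong const≈0 (∑-zero (λ v → trans (*-congʳ (coef≈0 v)) (zeroˡ (x v)))))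
          (+-identityˡ 0#)

  NontrivialKernel : ∀ {p s} → CMat 𝔽 p s → Set (c ⊔ ℓ)
  NontrivialKernel A = ∃ λ a → IsZeroVec (A ▸ a) × ∃ λ j → ¬ a j ≈ 0#

  zero-row : ∀ {p s} (A : CMat 𝔽 (suc p) s) → (∀ j → A Fin.zero j ≈ 0#) →
    NontrivialKernel (A ∘ Fin.suc) → NontrivialKernel A
  zero-row A row₀≈0 (a , A₊a≈0 , nonzero) = a , Aa≈0 , nonzero
    where
    Aa≈0 : IsZeroVec (A ▸ a)
    Aa≈0 Fin.zero    = ∑-zero (λ j → trans (*-congʳ (row₀≈0 j)) (zeroˡ (a j)))
    Aa≈0 (Fin.suc i) = A₊a≈0 i

  -- Gaussian elimination with pivot  π = A 0 j₀ ≠ 0.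
  module Pivot {p s} (A : CMat 𝔽 (suc p) (suc s)) (j₀ : Fin (suc s)) where

    π : Carrier
    π = A Fin.zero j₀

    A′ : CMat 𝔽 (suc p) s
    A′ i k = A i (punchIn j₀ k)

    eliminated : CMat 𝔽 p s
    eliminated i k = π * A′ (Fin.suc i) k + (- A (Fin.suc i) j₀) * A′ Fin.zero k

    back-substitute : Vec𝔽 s → Vec𝔽 (suc s)
    back-substitute b = insertAt (λ k → π * b k) j₀ (- (A′ ▸ b) Fin.zero)

    row-back-substituted : ∀ b i →
      (A ▸ back-substitute b) i ≈ π * (A′ ▸ b) i + (- A i j₀) * (A′ ▸ b) Fin.zero
    row-back-substituted b i = begin
      (A ▸ back-substitute b) i
        ≈⟨ ∑-remove (λ j → A i j * back-substitute b j) j₀ ⟩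
      A i j₀ * back-substitute b j₀ + ∑𝔽 (λ k → A′ i k * back-substitute b (punchIn j₀ k))
        ≈⟨ +-cong (*-congˡ (reflexive (insertAt-lookup _ j₀ _)))
                  (∑-cong (λ k → *-congˡ (reflexive (insertAt-punchIn _ j₀ _ k)))) ⟩
      A i j₀ * - T₀ + ∑𝔽 (λ k → A′ i k * (π * b k))
        ≈⟨ +-cong (sym (-‿distribʳ-* (A i j₀) T₀))
                  (trans (∑-cong (λ k → x∙yz≈y∙xz (A′ i k) π (b k))) (∑-*ˡ π (λ k → A′ i k * b k))) ⟩
      - (A i j₀ * T₀) + π * (A′ ▸ b) i
        ≈⟨ +-comm _ _ ⟩
      π * (A′ ▸ b) i + - (A i j₀ * T₀)
        ≈⟨ +-congˡ (-‿distribˡ-* (A i j₀) T₀) ⟩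
      π * (A′ ▸ b) i + (- A i j₀) * T₀ ∎
      where
      T₀ = (A′ ▸ b) Fin.zero

    lift-kernel : ¬ π ≈ 0# → NontrivialKernel eliminated → NontrivialKernel A
    lift-kernel π≉0 (b , Eb≈0 , k₁ , b≉0) =
      back-substitute b , Aa≈0 , punchIn j₀ k₁ , a≉0
      where
      T₀ = (A′ ▸ b) Fin.zero
      Aa≈0 : IsZeroVec (A ▸ back-substitute b)
      Aa≈0 Fin.zero = begin
        (A ▸ back-substitute b) Fin.zero  ≈⟨ row-back-substituted b Fin.zero ⟩
        π * T₀ + (- π) * T₀               ≈⟨ sym (distribʳ T₀ π (- π)) ⟩
        (π + - π) * T₀                    ≈⟨ *-congʳ (-‿inverseʳ π) ⟩
        0# * T₀                           ≈⟨ zeroˡ T₀ ⟩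
        0#                                ∎
      Aa≈0 (Fin.suc i) = begin
        (A ▸ back-substitute b) (Fin.suc i)
          ≈⟨ row-back-substituted b (Fin.suc i) ⟩
        π * (A′ ▸ b) (Fin.suc i) + (- A (Fin.suc i) j₀) * T₀
          ≈⟨ sym (∑-lincomb π (- A (Fin.suc i) j₀) (A′ (Fin.suc i)) (A′ Fin.zero) b) ⟩
        (eliminated ▸ b) i
          ≈⟨ Eb≈0 i ⟩
        0# ∎
      a≉0 : ¬ back-substitute b (punchIn j₀ k₁) ≈ 0#
      a≉0 rewrite insertAt-punchIn (λ k → π * b k) j₀ (- T₀) k₁ = *-nonzero π≉0 b≉0

  nontrivial-kernel : ∀ {p s} → p < s → (A : CMat 𝔽 p s) → ¬ ¬ NontrivialKernel A
  nontrivial-kernel {zero} {suc s} _ A k =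
    k ((λ _ → 1#) , (λ ()) , Fin.zero , λ 1≈0 → 0≉1 (sym 1≈0))
  nontrivial-kernel {suc p} {suc s} (s≤s p<s) A =
    ¬¬-bind (¬¬-all-or-counterexample (suc s) (λ j → A Fin.zero j ≈ 0#)) λ
      { (inj₁ row₀≈0) →
          ¬¬-map (zero-row A row₀≈0) (nontrivial-kernel (ℕP.m<n⇒m<1+n p<s) (A ∘ Fin.suc))
      ; (inj₂ (j₀ , pivot≉0)) →
          ¬¬-map (Pivot.lift-kernel A j₀ pivot≉0) (nontrivial-kernel p<s (Pivot.eliminated A j₀)) }

  module Reordering {n} (F : Subset n) (σ : Fin n → Fin n) (isQ : IsQ 𝔽 F σ)
                    {t} (eqn : ∣ F ∣ ℕ.+ t ≡ n) where
    open Blocks {∣ F ∣} {t} eqn public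

    private
      σ-injective = proj₁ isQ
      σ-surjective = proj₁ (proj₂ isQ)
      σ-left-is-F = proj₁ (proj₂ (proj₂ isQ))

    τ : Fin n → Fin n
    τ c = proj₁ (σ-surjective c)

    σ∘τ : ∀ c → σ (τ c) ≡ c
    σ∘τ c = proj₂ (σ-surjective c) ≡.refl

    τ∘σ : ∀ q → τ (σ q) ≡ q
    τ∘σ q = σ-injective (σ∘τ (σ q))

    lft-∈F : ∀ j → σ (lft j) ∈ F
    lft-∈F j = proj₁ (σ-left-is-F (lft j)) (toℕ-lft j)

    rgt-∉F : ∀ j → σ (rgt j) ∉ F
    rgt-∉F j σrgt∈F = ℕP.<⇒≱ (proj₂ (σ-left-is-F (rgt j)) σrgt∈F) (toℕ-rgt j)

    σ-cover : ∀ c → (∃ λ j → σ (lft j) ≡ c) ⊎ (∃ λ j → σ (rgt j) ≡ c)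
    σ-cover c with cover (τ c)
    ... | inj₁ (j , lft≡τc) = inj₁ (j , ≡.trans (≡.cong σ lft≡τc) (σ∘τ c))
    ... | inj₂ (j , rgt≡τc) = inj₂ (j , ≡.trans (≡.cong σ rgt≡τc) (σ∘τ c))

    ∑-reorder : ∀ h → ∑𝔽 h ≈ ∑𝔽 (h ∘ σ ∘ lft) + ∑𝔽 (h ∘ σ ∘ rgt)
    ∑-reorder h = trans (∑-permute σ τ σ∘τ τ∘σ h) (∑-blocks {∣ F ∣} {t} eqn (h ∘ σ))

    place : Vec𝔽 ∣ F ∣ → Vec𝔽 n
    place b c = join b (λ _ → 0#) (τ c)

    place-lft : ∀ b j → place b (σ (lft j)) ≡ b j
    place-lft b j = ≡.trans (≡.cong (join b (λ _ → 0#)) (τ∘σ (lft j))) (join-lft b _ j)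

    place-rgt : ∀ b j → place b (σ (rgt j)) ≡ 0#
    place-rgt b j = ≡.trans (≡.cong (join b (λ _ → 0#)) (τ∘σ (rgt j))) (join-rgt b _ j)

    place-outside : ∀ b c → c ∉ F → place b c ≈ 0#
    place-outside b c c∉F with σ-cover c
    ... | inj₁ (j , ≡.refl) = ⊥-elim (c∉F (lft-∈F j))
    ... | inj₂ (j , ≡.refl) = reflexive (place-rgt b j)

    ▸-place : ∀ {m} (Y : CMat 𝔽 m n) b l → (Y ▸ place b) l ≈ ∑𝔽 (λ j → Y l (σ (lft j)) * b j)
    ▸-place Y b l = begin
      (Y ▸ place b) l
        ≈⟨ ∑-reorder (λ c → Y l c * place b c) ⟩
      ∑𝔽 (λ j → Y l (σ (lft j)) * place b (σ (lft j))) +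
      ∑𝔽 (λ j → Y l (σ (rgt j)) * place b (σ (rgt j)))
        ≈⟨ +-cong (∑-cong (λ j → *-congˡ (reflexive (place-lft b j))))
                  (∑-zero (λ j → trans (*-congˡ (reflexive (place-rgt b j))) (zeroʳ _))) ⟩
      ∑𝔽 (λ j → Y l (σ (lft j)) * b j) + 0#
        ≈⟨ +-identityʳ _ ⟩
      ∑𝔽 (λ j → Y l (σ (lft j)) * b j) ∎

    ▸-off-F : ∀ {m} (Y : CMat 𝔽 m n) u → (∀ c → c ∈ F → u c ≈ 0#) →
      ∀ l → (Y ▸ u) l ≈ ∑𝔽 (λ j → Y l (σ (rgt j)) * u (σ (rgt j)))
    ▸-off-F Y u u|F≈0 l = begin
      (Y ▸ u) l
        ≈⟨ ∑-reorder (λ c → Y l c * u c) ⟩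
      ∑𝔽 (λ j → Y l (σ (lft j)) * u (σ (lft j))) + ∑𝔽 (λ j → Y l (σ (rgt j)) * u (σ (rgt j)))
        ≈⟨ +-congʳ (∑-zero (λ j → trans (*-congˡ (u|F≈0 _ (lft-∈F j))) (zeroʳ _))) ⟩
      0# + ∑𝔽 (λ j → Y l (σ (rgt j)) * u (σ (rgt j)))
        ≈⟨ +-identityˡ _ ⟩
      ∑𝔽 (λ j → Y l (σ (rgt j)) * u (σ (rgt j))) ∎

    vanishing : ∀ u → (∀ c → c ∈ F → u c ≈ 0#) → (∀ j → u (σ (rgt j)) ≈ 0#) → IsZeroVec u
    vanishing u u|F≈0 u|rgt≈0 c with σ-cover c
    ... | inj₁ (j , ≡.refl) = u|F≈0 _ (lft-∈F j)
    ... | inj₂ (j , ≡.refl) = u|rgt≈0 j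

  SupportedKernelVector : ∀ {m n} → CMat 𝔽 m n → Subset n → Vec𝔽 n → Set ℓ
  SupportedKernelVector X F u =
    IsZeroVec (X ▸ u) × (∀ c → c ∉ F → u c ≈ 0#) × ∃ λ c → ¬ u c ≈ 0#

  KernelRigidOutside : ∀ {m n} → CMat 𝔽 m n → Subset n → Set (c ⊔ ℓ)
  KernelRigidOutside X G =
    ∀ u → IsZeroVec (X ▸ u) → (∀ c → c ∈ G → u c ≈ 0#) → IsZeroVec u

  -- For a wide matrix, every completion has a nonzero kernel vector
  -- supported in a given semifactor set: extend a kernel vector of the
  -- wide upper-left block A by zero.
  semifactor-kernel : ∀ {k m n} {M : PMat 𝔽 k m n} {F : Subset n} → m < n →
    SemifactorSet 𝔽 M F → ∀ x → ¬ ¬ ∃ (SupportedKernelVector (complete 𝔽 x M) F)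
  semifactor-kernel {M = M} {F} m<n
    (σ , isQ , R , R-nonsingular , p , r , _ , eqm , eqn , eqmax , lower-left≈0 , _) x =
    ¬¬-map kernel-vector (nontrivial-kernel (wide-upper-block eqm eqn eqmax m<n) A)
    where
    open Reordering F σ isQ eqn
    module Rows = Blocks {p} {r} eqm

    Y = complete 𝔽 x (_⊙_ 𝔽 R M)

    A : CMat 𝔽 p ∣ F ∣
    A i j = Y (Rows.lft i) (σ (lft j))

    kernel-vector : NontrivialKernel A → ∃ (SupportedKernelVector (complete 𝔽 x M) F)
    kernel-vector (b , Ab≈0 , j₁ , b≉0) =
      place b , nonsingular-injective R-nonsingular RXu≈0 , place-outside b ,
      σ (lft j₁) , λ u≈0 → b≉0 (trans (reflexive (≡.sym (place-lft b j₁))) u≈0)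
      where
      Yu≈0 : IsZeroVec (Y ▸ place b)
      Yu≈0 l with Rows.cover l
      ... | inj₁ (i , ≡.refl) = trans (▸-place Y b l) (Ab≈0 i)
      ... | inj₂ (i , ≡.refl) = trans (▸-place Y b l)
              (∑-zero (λ j → trans (*-congʳ (evalAff-zero x (lower-left≈0 i j))) (zeroˡ _)))
      RXu≈0 : IsZeroVec (R ▸ complete 𝔽 x M ▸ place b)
      RXu≈0 l = trans (sym (complete-⊙-▸ x R M (place b) l)) (Yu≈0 l)

  -- For a semifactor set G some completion is rigid outside G: a kernel
  -- vector vanishing on G is, on the right block, a kernel vector of the
  -- FCmR block C.  If C is degenerate, the right block is empty.
  semifactor-rigid : ∀ {k m n} {M : PMat 𝔽 k m n} {G : Subset n} →
    SemifactorSet 𝔽 M G → ∃ λ x → KernelRigidOutside (complete 𝔽 x M) G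
  semifactor-rigid {G = G}
    (σ , isQ , _ , _ , _ , _ , t , _ , eqn , eqmax , _ , _ , inj₁ r≡0) =
    (λ _ → 0#) , λ u _ u|G≈0 → vanishing u u|G≈0 (λ j → ⊥-elim (right-block-empty j))
    where
    open Reordering G σ isQ eqn
    right-block-empty : Fin t → ⊥
    right-block-empty j = ℕP.n≮0 (ℕP.<-≤-trans (FinP.toℕ<n j)
                                    (≡.subst (t ≤_) r≡0 (lower-right-block eqn eqmax)))
  semifactor-rigid {M = M} {G}
    (σ , isQ , R , _ , p , r , _ , eqm , eqn , _ , _ , _ , inj₂ (x , C-independent)) =
    x , λ u Xu≈0 u|G≈0 → vanishing u u|G≈0 (C-independent (u ∘ σ ∘ rgt) (Ca≈0 u Xu≈0 u|G≈0))
    where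
    open Reordering G σ isQ eqn
    module Rows = Blocks {p} {r} eqm
    Ca≈0 : ∀ u → IsZeroVec (complete 𝔽 x M ▸ u) → (∀ c → c ∈ G → u c ≈ 0#) →
      ∀ i → ∑𝔽 (λ j → complete 𝔽 x (_⊙_ 𝔽 R M) (Rows.rgt i) (σ (rgt j)) * u (σ (rgt j))) ≈ 0#
    Ca≈0 u Xu≈0 u|G≈0 i = begin
      ∑𝔽 (λ j → Y (Rows.rgt i) (σ (rgt j)) * u (σ (rgt j)))  ≈⟨ sym (▸-off-F Y u u|G≈0 (Rows.rgt i)) ⟩
      (Y ▸ u) (Rows.rgt i)                                   ≈⟨ complete-⊙-▸ x R M u (Rows.rgt i) ⟩
      (R ▸ complete 𝔽 x M ▸ u) (Rows.rgt i)                  ≈⟨ ▸-zero R Xu≈0 (Rows.rgt i) ⟩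
      0#                                                     ∎
      where
      Y = complete 𝔽 x (_⊙_ 𝔽 R M)

-- Theorem (Lemma 5.2).  Any two semifactor sets of a wide ACI-matrix
-- intersect.
lemma5p2 : ∀ {c ℓ : Level} (𝔽 : Field c ℓ) (k m n : ℕ) (M : PMat 𝔽 k m n) →
    IsACI 𝔽 M → m < n →
    (F G : Subset n) → SemifactorSet 𝔽 M F → SemifactorSet 𝔽 M G →
    ∃[ j ] (j ∈ F × j ∈ G)
lemma5p2 𝔽 k m n M _ m<n F G F-semifactor G-semifactor =
  decidable-stable (FinP.any? (λ j → (j ∈? F) ×-dec (j ∈? G))) λ disjoint →
  let (x , rigid) = semifactor-rigid 𝔽 {M = M} G-semifactor in
  semifactor-kernel 𝔽 {M = M} m<n F-semifactor x λ (u , Xu≈0 , u|F , c , u≉0) →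
  u≉0 (rigid u Xu≈0 (λ c c∈G → u|F c (λ c∈F → disjoint (c , c∈F , c∈G))) c)
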